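{- Let $q=ef+1=\epsilon\rho+1$ be a prime power, where $e,f,\epsilon,\rho>1$ are integers, $\epsilon\mid e$ and $e>\epsilon$. Let ${C_0^\epsilon}'=\{C_0^e,C_\epsilon^e,\ldots,C_{e-\epsilon}^e\}$ and suppose ${C_0^\epsilon}'$ is a $(q,\frac{e}{\epsilon},f,\phi_0,\phi_1)$-disjoint partial difference family. (i) If $\epsilon>f$, then $\phi_0=f-1$ and $\phi_1=0$, i.e. ${C_0^\epsilon}'$ is a $(q,\frac{e}{\epsilon},f,f-1,0)$-disjoint partial difference family. (ii) If $\epsilon>2$ and $\epsilon=f$, then ${C_0^\epsilon}'$ is a $(q,\frac{e}{\epsilon},f,f-1,0)$-disjoint partial difference family. (iii) If moreover $C_0^\epsilon$ is a $(q,\rho,\lambda,\mu)$-partial difference set, then in both cases (i) and (ii), ${C_0^\epsilon}'$ is a $(q,\frac{e}{\epsilon},f,\lambda-f+1,\mu)$-external partial difference family, which is proper unless $\mu-\lambda=f-1$.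
   Context: $G=(GF(q),+)$, $G^*=G\setminus\{0\}$; $\alpha$ a primitive element; $C_i^d=\alpha^i\langle\alpha^d\rangle$ for $d\mid q-1$; the sets of ${C_0^\epsilon}'$ partition $C_0^\epsilon$. $\Delta(D)$ is the multiset $\{x-y:x,y\in D,x\neq y\}$, $\Delta(D_1,D_2)$ the multiset $\{x-y:x\in D_1,y\in D_2\}$, $\lambda A$ is $\lambda$ copies of each element of $A$. $P$ is a $(q,k,\lambda,\mu)$-partial difference set if $|P|=k$ and $\Delta(P)=\lambda P+\mu(G^*\setminus P)$. For a family of $m$ disjoint $k$-subsets $D_i$ of $G^*$ with union $S$: $(q,m,k,\lambda,\mu)$-disjoint (resp. external) partial difference family means $\bigcup_i\Delta(D_i)$ (resp. $\bigcup_{i\neq j}\Delta(D_i,D_j)$) equals $\lambda S+\mu(G^*\setminus S)$; proper means $\lambda\neq\mu$. -}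

module Defs where

open import Level using (0ℓ)
open import Data.Nat as ℕ using (ℕ; zero; suc; _≤_; _<_)
open import Data.Nat.Primality using (Prime)
open import Data.Fin as Fin using (Fin)
open import Data.Fin.Properties using () renaming (_≟_ to _≟F_)
open import Data.List using (List; []; _∷_; [_]; length; filter; map; concatMap; upTo; allFin)
open import Data.List.Relation.Unary.All using (All)
open import Data.List.Relation.Unary.Unique.Propositional using (Unique)
open import Data.List.Membership.Propositional using (_∈_; _∉_)
open import Data.Product using (Σ; ∃; _×_; _,_)
open import Data.Bool using (if_then_else_)
open import Relation.Nullary using (¬_; Dec; yes; no)
open import Relation.Nullary.Decidable using (⌊_⌋)
open import Relation.Binary.PropositionalEquality using (_≡_; _≢_)
open import Algebra.Structures using (IsCommutativeRing)

IsPrimePower : ℕ → Set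
IsPrimePower q = Σ ℕ λ p → Σ ℕ λ k → Prime p × 1 ≤ k × q ≡ p ℕ.^ k

-- A finite field with q elements, presented (w.l.o.g., up to isomorphism)
-- on the carrier Fin q with propositional equality.
record FiniteField (q : ℕ) : Set where
  field
    _+_ _*_ : Fin q → Fin q → Fin q
    -_      : Fin q → Fin q
    0# 1#   : Fin q
    isCommutativeRing : IsCommutativeRing _≡_ _+_ _*_ -_ 0# 1#
    0≢1     : 0# ≢ 1#
    inverse : ∀ x → x ≢ 0# → Σ (Fin q) λ y → x * y ≡ 1#

module FF {q : ℕ} (F : FiniteField q) where
  open FiniteField F public
  open import Data.List.Membership.DecPropositional (_≟F_ {q}) using (_∈?_)

  _-_ : Fin q → Fin q → Fin q
  x - y = x + (- y)

  infixr 8 _^_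
  _^_ : Fin q → ℕ → Fin q
  x ^ zero  = 1#
  x ^ suc n = x * (x ^ n)

  Primitive : Fin q → Set
  Primitive α = (α ^ (q ℕ.∸ 1) ≡ 1#) × (∀ i → 0 < i → i < q ℕ.∸ 1 → α ^ i ≢ 1#)

  -- cyclotomic class C_i^d = α^i ⟨α^d⟩, listed as α^(i + d j), j = 0 .. n-1,
  -- where n = (q-1)/d is the size of the class
  Cyc : Fin q → ℕ → ℕ → ℕ → List (Fin q)
  Cyc α i d n = map (λ j → α ^ (i ℕ.+ d ℕ.* j)) (upTo n)

  count : Fin q → List (Fin q) → ℕ
  count z L = length (filter (z ≟F_) L)

  Δ : List (Fin q) → List (Fin q)
  Δ D = concatMap (λ x → concatMap (λ y → if ⌊ x ≟F y ⌋ then [] else [ x - y ]) D) D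

  Δ₂ : List (Fin q) → List (Fin q) → List (Fin q)
  Δ₂ D₁ D₂ = concatMap (λ x → map (λ y → x - y) D₂) D₁

  -- multiplicity of z in the multiset λS + μ(G* \ S)
  target : List (Fin q) → ℕ → ℕ → Fin q → ℕ
  target S l m z =
    (if ⌊ z ∈? S ⌋ then l else 0)
    ℕ.+ (if ⌊ z ≟F 0# ⌋ then 0 else (if ⌊ z ∈? S ⌋ then 0 else m))

  IsKSubset : List (Fin q) → ℕ → Set
  IsKSubset D k = Unique D × length D ≡ k

  IsPDS : List (Fin q) → ℕ → ℕ → ℕ → Set
  IsPDS P k l m = IsKSubset P k × (∀ z → count z (Δ P) ≡ target P l m z)

  union : {m : ℕ} → (Fin m → List (Fin q)) → List (Fin q)
  union {m} D = concatMap D (allFin m)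

  IsFamily : (m : ℕ) → (Fin m → List (Fin q)) → ℕ → Set
  IsFamily m D k = (∀ i → IsKSubset (D i) k × All (_≢ 0#) (D i))
                 × (∀ i j → i ≢ j → ∀ x → x ∈ D i → x ∉ D j)

  IsDPDF : (m : ℕ) → (Fin m → List (Fin q)) → ℕ → ℕ → ℕ → Set
  IsDPDF m D k l μ = IsFamily m D k
    × (∀ z → count z (concatMap (λ i → Δ (D i)) (allFin m)) ≡ target (union D) l μ z)

  IsEPDF : (m : ℕ) → (Fin m → List (Fin q)) → ℕ → ℕ → ℕ → Set
  IsEPDF m D k l μ = IsFamily m D k
    × (∀ z → count z (concatMap (λ i → concatMap (λ j →
                 if ⌊ i ≟F j ⌋ then [] else Δ₂ (D i) (D j)) (allFin m)) (allFin m))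
             ≡ target (union D) l μ z)

-- Counting all internal differences of the m blocks C_{εi}^e, each of size f, gives
-- m f (f - 1) = φ₀ m f + φ₁ (q - 1 - m f), i.e. f - 1 = φ₀ + φ₁ (ε - 1) since q - 1 = m ε f.
-- For ε > f this forces φ₁ = 0.  For ε = f the only other solution is (φ₀, φ₁) = (0, 1), which
-- fails when f > 2: internal differences come in pairs ±d and 1 ∈ C_0^e is never one of them,
-- so -1 lies in some block C_{εs}^e; then 1 - α^e arises both from the pair (1, α^e) of C_0^e and
-- from the pair (-α^e, -1) of C_{εs}^e, hence at least twice.  For (iii), the blocks partition
-- C_0^ε, so every difference of C_0^ε is internal or external, and the external counts are the
-- (λ, μ) counts of the partial difference set minus the (f - 1, 0) internal ones.
module Submission where

open import Data.Nat as ℕ using (ℕ)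
open import Data.Fin using (Fin)
open import Relation.Binary.PropositionalEquality using (_≡_)
open import Defs

module Sums where
  open import Data.Nat using (ℕ; _+_; _*_; _≤_)
  open import Data.Nat.Properties
  open import Data.Product using (_,_)
  open import Function using (_∘′_)
  open import Data.Product.Properties using (≡-dec)
  open import Data.List using (List; []; _∷_; _++_; length; map; concatMap)
  open import Data.List.Membership.Propositional using (_∈_)
  open import Data.List.Relation.Unary.Any using (here; there)
  open import Relation.Binary.Definitions using (DecidableEquality)
  open import Relation.Binary.PropositionalEquality
  open import Relation.Nullary using (yes; no; contradiction)
  open import Algebra.Properties.CommutativeSemigroup +-commutativeSemigroup using (interchange)

  ∑ : {A : Set} → (A → ℕ) → List A → ℕ
  ∑ g []       = 0
  ∑ g (x ∷ xs) = g x + ∑ g xs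

  module _ {A : Set} where

    ∑-++ : (g : A → ℕ) (xs ys : List A) → ∑ g (xs ++ ys) ≡ ∑ g xs + ∑ g ys
    ∑-++ g []       ys = refl
    ∑-++ g (x ∷ xs) ys = trans (cong (g x +_) (∑-++ g xs ys)) (sym (+-assoc (g x) _ _))

    ∑-cong-∈ : {g h : A → ℕ} (xs : List A) → (∀ {x} → x ∈ xs → g x ≡ h x) → ∑ g xs ≡ ∑ h xs
    ∑-cong-∈ []       g≡h = refl
    ∑-cong-∈ (x ∷ xs) g≡h = cong₂ _+_ (g≡h (here refl)) (∑-cong-∈ xs (g≡h ∘′ there))

    ∑-cong : {g h : A → ℕ} (xs : List A) → (∀ x → g x ≡ h x) → ∑ g xs ≡ ∑ h xs
    ∑-cong xs g≡h = ∑-cong-∈ xs (λ {x} _ → g≡h x)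

    ∑-+ : (g h : A → ℕ) (xs : List A) → ∑ (λ x → g x + h x) xs ≡ ∑ g xs + ∑ h xs
    ∑-+ g h []       = refl
    ∑-+ g h (x ∷ xs) =
      trans (cong (g x + h x +_) (∑-+ g h xs)) (interchange (g x) (h x) (∑ g xs) (∑ h xs))

    ∑-*ˡ : (c : ℕ) (g : A → ℕ) (xs : List A) → ∑ (λ x → c * g x) xs ≡ c * ∑ g xs
    ∑-*ˡ c g []       = sym (*-zeroʳ c)
    ∑-*ˡ c g (x ∷ xs) = trans (cong (c * g x +_) (∑-*ˡ c g xs)) (sym (*-distribˡ-+ c (g x) _))

    ∑-*ʳ : (c : ℕ) (g : A → ℕ) (xs : List A) → ∑ (λ x → g x * c) xs ≡ ∑ g xs * c
    ∑-*ʳ c g xs = trans (∑-cong xs (λ x → *-comm (g x) c)) (trans (∑-*ˡ c g xs) (*-comm c (∑ g xs)))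

    ∑-const : (c : ℕ) (xs : List A) → ∑ (λ _ → c) xs ≡ length xs * c
    ∑-const c []       = refl
    ∑-const c (x ∷ xs) = cong (c +_) (∑-const c xs)

    length≡∑1 : (xs : List A) → length xs ≡ ∑ (λ _ → 1) xs
    length≡∑1 xs = sym (trans (∑-const 1 xs) (*-identityʳ _))

    ∑-∈ : (g : A → ℕ) {x : A} {xs : List A} → x ∈ xs → g x ≤ ∑ g xs
    ∑-∈ g {xs = y ∷ xs} (here refl) = m≤m+n (g y) _
    ∑-∈ g {xs = y ∷ xs} (there x∈) = ≤-trans (∑-∈ g x∈) (m≤n+m _ (g y))

    ∑-∈₂ : (g : A → ℕ) {x y : A} {xs : List A} → x ≢ y → x ∈ xs → y ∈ xs → g x + g y ≤ ∑ g xs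
    ∑-∈₂ g {xs = z ∷ xs} x≢y (here refl) (here refl) = contradiction refl x≢y
    ∑-∈₂ g {xs = z ∷ xs} x≢y (here refl) (there y∈) = +-monoʳ-≤ (g z) (∑-∈ g y∈)
    ∑-∈₂ g {x} {y} {z ∷ xs} x≢y (there x∈) (here refl) =
      subst (_≤ g y + ∑ g xs) (+-comm (g y) (g x)) (+-monoʳ-≤ (g y) (∑-∈ g x∈))
    ∑-∈₂ g {xs = z ∷ xs} x≢y (there x∈) (there y∈) = ≤-trans (∑-∈₂ g x≢y x∈ y∈) (m≤n+m _ (g z))

  module _ {A B : Set} where

    ∑-map : (g : B → ℕ) (h : A → B) (xs : List A) → ∑ g (map h xs) ≡ ∑ (λ x → g (h x)) xs
    ∑-map g h []       = refl
    ∑-map g h (x ∷ xs) = cong (g (h x) +_) (∑-map g h xs)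

    ∑-concatMap : (g : B → ℕ) (h : A → List B) (xs : List A) →
                  ∑ g (concatMap h xs) ≡ ∑ (λ x → ∑ g (h x)) xs
    ∑-concatMap g h []       = refl
    ∑-concatMap g h (x ∷ xs) = trans (∑-++ g (h x) (concatMap h xs)) (cong (∑ g (h x) +_) (∑-concatMap g h xs))

    length-concatMap : (h : A → List B) (xs : List A) → length (concatMap h xs) ≡ ∑ (λ x → length (h x)) xs
    length-concatMap h xs = trans (length≡∑1 (concatMap h xs))
      (trans (∑-concatMap (λ _ → 1) h xs) (∑-cong xs (λ x → sym (length≡∑1 (h x)))))

    ∑-comm : (g : A → B → ℕ) (xs : List A) (ys : List B) →
             ∑ (λ x → ∑ (g x) ys) xs ≡ ∑ (λ y → ∑ (λ x → g x y) xs) ys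
    ∑-comm g []       ys = sym (trans (∑-const 0 ys) (*-zeroʳ (length ys)))
    ∑-comm g (x ∷ xs) ys = trans (cong (∑ (g x) ys +_) (∑-comm g xs ys)) (sym (∑-+ (g x) _ ys))

  module _ {A B C : Set} where

    ∑∑∑-∈₂ : DecidableEquality A → DecidableEquality B → (t : A → B → C → ℕ)
             {xs : List A} {ys : List B} {zs : List C} {x x′ : A} {y y′ : B} {z z′ : C} →
             (x , y , z) ≢ (x′ , y′ , z′) →
             x ∈ xs → x′ ∈ xs → y ∈ ys → y′ ∈ ys → z ∈ zs → z′ ∈ zs →
             t x y z + t x′ y′ z′ ≤ ∑ (λ a → ∑ (λ b → ∑ (t a b) zs) ys) xs
    ∑∑∑-∈₂ _≟A_ _≟B_ t {xs} {ys} {zs} {x} {x′} {y} {y′} {z} {z′} ≢ x∈ x′∈ y∈ y′∈ z∈ z′∈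
      with ≡-dec _≟A_ _≟B_ (x , y) (x′ , y′)
    ... | yes refl = ≤-trans (∑-∈₂ (t x y) (λ z≡z′ → ≢ (cong (λ c → x , y , c) z≡z′)) z∈ z′∈)
                       (≤-trans (∑-∈ (λ b → ∑ (t x b) zs) y∈) (∑-∈ (λ a → ∑ (λ b → ∑ (t a b) zs) ys) x∈))
    ... | no xy≢ with x ≟A x′
    ...   | yes refl = ≤-trans (+-mono-≤ (∑-∈ (t x y) z∈) (∑-∈ (t x y′) z′∈))
                         (≤-trans (∑-∈₂ (λ b → ∑ (t x b) zs) (λ y≡y′ → xy≢ (cong (x ,_) y≡y′)) y∈ y′∈)
                                  (∑-∈ (λ a → ∑ (λ b → ∑ (t a b) zs) ys) x∈))
    ...   | no x≢x′ = ≤-trans (+-mono-≤ (≤-trans (∑-∈ (t x y) z∈) (∑-∈ (λ b → ∑ (t x b) zs) y∈))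
                                          (≤-trans (∑-∈ (t x′ y′) z′∈) (∑-∈ (λ b → ∑ (t x′ b) zs) y′∈)))
                        (∑-∈₂ (λ a → ∑ (λ b → ∑ (t a b) zs) ys) x≢x′ x∈ x′∈)

module Multiplicity {n : ℕ} where
  open import Data.Nat using (suc; _+_; _*_)
  open import Data.Nat.Properties using (+-identityʳ; *-identityˡ)
  open import Data.Fin using (Fin)
  open import Data.Fin.Properties using (_≟_)
  open import Data.List using (List; []; _∷_; length; filter; allFin)
  open import Data.List.Membership.Propositional using (_∈_; _∉_)
  open import Data.List.Membership.Propositional.Properties using (∈-allFin)
  open import Data.List.Membership.DecPropositional (_≟_ {n}) using (_∈?_)
  open import Data.List.Relation.Unary.Any using (here; there)
  open import Data.List.Relation.Unary.All.Properties using (All¬⇒¬Any)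
  open import Data.List.Relation.Unary.Unique.Propositional using (Unique; _∷_)
  open import Data.List.Relation.Unary.Unique.Propositional.Properties using (allFin⁺)
  open import Data.Bool using (if_then_else_)
  open import Relation.Nullary using (yes; no; contradiction)
  open import Relation.Nullary.Decidable using (⌊_⌋)
  open import Relation.Binary.PropositionalEquality
  open import Function using (_∘_; _⇔_; Equivalence)
  open Sums

  δ : Fin n → Fin n → ℕ
  δ a b = if ⌊ a ≟ b ⌋ then 1 else 0

  length-filter≡∑δ : ∀ z xs → length (filter (z ≟_) xs) ≡ ∑ (δ z) xs
  length-filter≡∑δ z []       = refl
  length-filter≡∑δ z (x ∷ xs) with z ≟ x
  ... | yes _ = cong suc (length-filter≡∑δ z xs)
  ... | no _  = length-filter≡∑δ z xs

  δ-sym : ∀ a b → δ a b ≡ δ b a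
  δ-sym a b with a ≟ b | b ≟ a
  ... | yes _   | yes _   = refl
  ... | no _    | no _    = refl
  ... | yes a≡b | no b≢a  = contradiction (sym a≡b) b≢a
  ... | no a≢b  | yes b≡a = contradiction (sym b≡a) a≢b

  δ-refl : ∀ a → δ a a ≡ 1
  δ-refl a with a ≟ a
  ... | yes _  = refl
  ... | no a≢a = contradiction refl a≢a

  ∑δ-* : ∀ x (h : Fin n → ℕ) xs → ∑ (λ w → δ x w * h w) xs ≡ ∑ (δ x) xs * h x
  ∑δ-* x h []       = refl
  ∑δ-* x h (w ∷ xs) with x ≟ w
  ... | yes refl = cong₂ _+_ (*-identityˡ (h x)) (∑δ-* x h xs)
  ... | no _     = ∑δ-* x h xs

  ∑δ-∉ : ∀ x xs → x ∉ xs → ∑ (δ x) xs ≡ 0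
  ∑δ-∉ x []       _   = refl
  ∑δ-∉ x (w ∷ xs) x∉ with x ≟ w
  ... | yes refl = contradiction (here refl) x∉
  ... | no _     = ∑δ-∉ x xs (x∉ ∘ there)

  ∑δ-∈ : ∀ x xs → Unique xs → x ∈ xs → ∑ (δ x) xs ≡ 1
  ∑δ-∈ x (w ∷ xs) (w∉xs ∷ _) x∈ with x ≟ w
  ∑δ-∈ x (w ∷ xs) (w∉xs ∷ _)  _           | yes refl = cong suc (∑δ-∉ x xs (All¬⇒¬Any w∉xs))
  ∑δ-∈ x (w ∷ xs) _           (here refl) | no x≢w   = contradiction refl x≢w
  ∑δ-∈ x (w ∷ xs) (_ ∷ xs-u)  (there x∈)  | no _     = ∑δ-∈ x xs xs-u x∈

  ∑δ-unique : ∀ x xs → Unique xs → ∑ (δ x) xs ≡ (if ⌊ x ∈? xs ⌋ then 1 else 0)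
  ∑δ-unique x xs u with x ∈? xs
  ... | yes x∈ = ∑δ-∈ x xs u x∈
  ... | no x∉  = ∑δ-∉ x xs x∉

  ∑δ-allFin : ∀ x → ∑ (δ x) (allFin n) ≡ 1
  ∑δ-allFin x = ∑δ-∈ x (allFin n) (allFin⁺ n) (∈-allFin x)

  ∑≡∑-multiplicities : (g : Fin n → ℕ) (xs : List (Fin n)) →
                        ∑ g xs ≡ ∑ (λ w → ∑ (δ w) xs * g w) (allFin n)
  ∑≡∑-multiplicities g xs = begin
    ∑ g xs
      ≡⟨ ∑-cong xs (λ x → sym (trans (∑δ-* x g (allFin n))
                                (trans (cong (_* g x) (∑δ-allFin x)) (+-identityʳ (g x))))) ⟩
    ∑ (λ x → ∑ (λ w → δ x w * g w) (allFin n)) xs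
      ≡⟨ ∑-comm (λ x w → δ x w * g w) xs (allFin n) ⟩
    ∑ (λ w → ∑ (λ x → δ x w * g w) xs) (allFin n)
      ≡⟨ ∑-cong (allFin n) (λ w → trans (∑-*ʳ (g w) (λ x → δ x w) xs)
                                        (cong (_* g w) (∑-cong xs (λ x → δ-sym x w)))) ⟩
    ∑ (λ w → ∑ (δ w) xs * g w) (allFin n) ∎
    where open ≡-Reasoning

  ∑-resp-multiplicities : (g : Fin n → ℕ) (xs ys : List (Fin n)) →
                          (∀ w → ∑ (δ w) xs ≡ ∑ (δ w) ys) → ∑ g xs ≡ ∑ g ys
  ∑-resp-multiplicities g xs ys same = begin
    ∑ g xs                                  ≡⟨ ∑≡∑-multiplicities g xs ⟩
    ∑ (λ w → ∑ (δ w) xs * g w) (allFin n)   ≡⟨ ∑-cong (allFin n) (λ w → cong (_* g w) (same w)) ⟩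
    ∑ (λ w → ∑ (δ w) ys * g w) (allFin n)   ≡⟨ ∑≡∑-multiplicities g ys ⟨
    ∑ g ys                                  ∎
    where open ≡-Reasoning

  ∑-multiplicities≡length : (xs : List (Fin n)) → ∑ (λ w → ∑ (δ w) xs) (allFin n) ≡ length xs
  ∑-multiplicities≡length xs = begin
    ∑ (λ w → ∑ (δ w) xs) (allFin n)   ≡⟨ ∑-comm δ (allFin n) xs ⟩
    ∑ (λ x → ∑ (λ w → δ w x) (allFin n)) xs
      ≡⟨ ∑-cong xs (λ x → trans (∑-cong (allFin n) (λ w → δ-sym w x)) (∑δ-allFin x)) ⟩
    ∑ (λ _ → 1) xs                    ≡⟨ length≡∑1 xs ⟨
    length xs                         ∎
    where open ≡-Reasoning

  same-multiplicities : ∀ {xs ys} → Unique xs → Unique ys → (∀ x → x ∈ xs ⇔ x ∈ ys) →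
                        ∀ w → ∑ (δ w) xs ≡ ∑ (δ w) ys
  same-multiplicities {xs} {ys} xs-u ys-u xs≈ys w with w ∈? xs | w ∈? ys
  ... | yes w∈xs | _       = trans (∑δ-∈ w xs xs-u w∈xs) (sym (∑δ-∈ w ys ys-u (Equivalence.to (xs≈ys w) w∈xs)))
  ... | no w∉xs  | yes w∈ys = contradiction (Equivalence.from (xs≈ys w) w∈ys) w∉xs
  ... | no w∉xs  | no w∉ys  = trans (∑δ-∉ w xs w∉xs) (sym (∑δ-∉ w ys w∉ys))

module FieldLemmas {q : ℕ} (F : FiniteField q) where
  open import Level using (0ℓ)
  open import Data.Nat using (zero; suc)
  open import Data.Nat.Properties using (*-zeroʳ; *-suc)
  open import Data.Fin using (Fin)
  open import Data.Product using (proj₁)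
  open import Algebra.Bundles using (CommutativeRing)
  open import Relation.Binary.PropositionalEquality
  open FF F

  private
    commutativeRing : CommutativeRing 0ℓ 0ℓ
    commutativeRing = record { isCommutativeRing = isCommutativeRing }

  open CommutativeRing commutativeRing using (+-comm; *-identityˡ; *-identityʳ; *-assoc)
  open import Algebra.Properties.Ring (CommutativeRing.ring commutativeRing) public
    using (-‿involutive; -‿injective; -0#≈0#; ⁻¹-anti-homo‿-; -1*x≈-x)

  -1≢0 : - 1# ≢ 0#
  -1≢0 -1≡0 = 0≢1 (sym (trans (sym (-‿involutive 1#)) (trans (cong -_ -1≡0) -0#≈0#)))

  1-x≡-x-[-1] : ∀ x → 1# - x ≡ (- x) - (- 1#)
  1-x≡-x-[-1] x = trans (+-comm 1# (- x)) (cong ((- x) +_) (sym (-‿involutive 1#)))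

  ^-+ : ∀ x a b → x ^ (a ℕ.+ b) ≡ (x ^ a) * (x ^ b)
  ^-+ x zero    b = sym (*-identityˡ _)
  ^-+ x (suc a) b = trans (cong (x *_) (^-+ x a b)) (sym (*-assoc x _ _))

  ^-+-of-≡-1 : ∀ x a b → x ^ a ≡ - 1# → x ^ (a ℕ.+ b) ≡ - (x ^ b)
  ^-+-of-≡-1 x a b xᵃ≡-1 = trans (^-+ x a b) (trans (cong (_* (x ^ b)) xᵃ≡-1) (-1*x≈-x (x ^ b)))

  module _ {α : Fin q} (prim : Primitive α) where

    ^-period : ∀ k → α ^ ((q ℕ.∸ 1) ℕ.* k) ≡ 1#
    ^-period zero    = cong (α ^_) (*-zeroʳ (q ℕ.∸ 1))
    ^-period (suc k) = begin
      α ^ ((q ℕ.∸ 1) ℕ.* suc k)                    ≡⟨ cong (α ^_) (*-suc (q ℕ.∸ 1) k) ⟩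
      α ^ ((q ℕ.∸ 1) ℕ.+ (q ℕ.∸ 1) ℕ.* k)          ≡⟨ ^-+ α (q ℕ.∸ 1) _ ⟩
      (α ^ (q ℕ.∸ 1)) * (α ^ ((q ℕ.∸ 1) ℕ.* k))    ≡⟨ cong₂ _*_ (proj₁ prim) (^-period k) ⟩
      1# * 1#                                       ≡⟨ *-identityʳ 1# ⟩
      1#                                            ∎
      where open ≡-Reasoning

    ^-+-period : ∀ a k → α ^ (a ℕ.+ (q ℕ.∸ 1) ℕ.* k) ≡ α ^ a
    ^-+-period a k = trans (^-+ α a _) (trans (cong ((α ^ a) *_) (^-period k)) (*-identityʳ _))

module DifferenceFamily {q : ℕ} (F : FiniteField q) where
  open import Data.Nat using (_+_; _*_; _∸_; _≤_; z≤n)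
  open import Data.Nat.Tactic.RingSolver using (solve)
  open import Data.Nat.Properties hiding (_≟_)
  open import Data.Fin using (Fin)
  open import Data.Fin.Properties using (_≟_)
  open import Data.List using (List; []; _∷_; [_]; length; concatMap; allFin)
  open import Data.List.Properties using (length-tabulate)
  open import Data.List.Membership.Propositional using (_∈_; _∉_; lose)
  open import Data.List.Membership.Propositional.Properties using (∈-allFin; ∈-concatMap⁺; ∈-concatMap⁻)
  open import Data.List.Membership.DecPropositional (_≟_ {q}) using (_∈?_)
  open import Data.List.Relation.Unary.Any using (satisfied)
  open import Data.List.Relation.Unary.All as All using (All)
  import Data.List.Relation.Unary.All.Properties as All
  import Data.List.Relation.Unary.AllPairs as AllPairs
  import Data.List.Relation.Unary.AllPairs.Properties as AllPairs
  open import Data.List.Relation.Unary.Unique.Propositional using (Unique)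
  open import Data.List.Relation.Unary.Unique.Propositional.Properties using (allFin⁺; concat⁺)
  open import Data.Product using (∃; _,_; proj₁; proj₂)
  open import Data.Bool using (if_then_else_)
  open import Function using (id; _⇔_; Equivalence)
  open import Relation.Nullary using (yes; no; contradiction)
  open import Relation.Nullary.Decidable using (⌊_⌋)
  open import Relation.Binary.PropositionalEquality hiding ([_])
  open FF F hiding (_+_; _*_)
  open FieldLemmas F using (-‿injective; ⁻¹-anti-homo‿-)
  open Sums
  open Multiplicity

  count≡∑δ : ∀ z xs → count z xs ≡ ∑ (δ z) xs
  count≡∑δ = length-filter≡∑δ

  diff-count : Fin q → Fin q → Fin q → ℕ
  diff-count z x y = ∑ (δ z) (if ⌊ x ≟ y ⌋ then [] else [ x - y ])

  count-Δ : ∀ z xs → count z (Δ xs) ≡ ∑ (λ x → ∑ (diff-count z x) xs) xs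
  count-Δ z xs = trans (count≡∑δ z (Δ xs))
    (trans (∑-concatMap (δ z) _ xs) (∑-cong xs (λ x → ∑-concatMap (δ z) _ xs)))

  count-Δ-resp : ∀ {xs ys} → (∀ w → ∑ (δ w) xs ≡ ∑ (δ w) ys) → ∀ z → count z (Δ xs) ≡ count z (Δ ys)
  count-Δ-resp {xs} {ys} same z = begin
    count z (Δ xs)                              ≡⟨ count-Δ z xs ⟩
    ∑ (λ x → ∑ (diff-count z x) xs) xs          ≡⟨ ∑-resp-multiplicities _ xs ys same ⟩
    ∑ (λ x → ∑ (diff-count z x) xs) ys          ≡⟨ ∑-cong ys (λ x → ∑-resp-multiplicities _ xs ys same) ⟩
    ∑ (λ x → ∑ (diff-count z x) ys) ys          ≡⟨ count-Δ z ys ⟨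
    count z (Δ ys)                              ∎
    where open ≡-Reasoning

  diff-count-≢ : ∀ z {x y} → x ≢ y → diff-count z x y ≡ δ z (x - y)
  diff-count-≢ z {x} {y} x≢y with x ≟ y
  ... | yes x≡y = contradiction x≡y x≢y
  ... | no _    = +-identityʳ _

  diff-count-self : ∀ {x y} → x ≢ y → diff-count (x - y) x y ≡ 1
  diff-count-self {x} {y} x≢y = trans (diff-count-≢ (x - y) x≢y) (δ-refl (x - y))

  δ-neg : ∀ z w → δ z w ≡ δ (- z) (- w)
  δ-neg z w with z ≟ w | (- z) ≟ (- w)
  ... | yes _   | yes _     = refl
  ... | no _    | no _      = refl
  ... | yes z≡w | no -z≢-w  = contradiction (cong -_ z≡w) -z≢-w
  ... | no z≢w  | yes -z≡-w = contradiction (-‿injective -z≡-w) z≢w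

  diff-count-neg : ∀ z x y → diff-count z x y ≡ diff-count (- z) y x
  diff-count-neg z x y with x ≟ y | y ≟ x
  ... | yes _   | yes _   = refl
  ... | no _    | no _    = cong (_+ 0) (trans (δ-neg z (x - y)) (cong (δ (- z)) (⁻¹-anti-homo‿- x y)))
  ... | yes x≡y | no y≢x  = contradiction (sym x≡y) y≢x
  ... | no x≢y  | yes y≡x = contradiction (sym y≡x) x≢y

  length-Δ : ∀ {xs} → Unique xs → length (Δ xs) ≡ length xs * (length xs ∸ 1)
  length-Δ {xs} xs-u = begin
    length (Δ xs)                       ≡⟨ length-concatMap _ xs ⟩
    ∑ (λ x → length (differences x)) xs ≡⟨ ∑-cong-∈ xs length-differences ⟩
    ∑ (λ _ → length xs ∸ 1) xs          ≡⟨ ∑-const _ xs ⟩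
    length xs * (length xs ∸ 1)         ∎
    where
    open ≡-Reasoning
    differences : Fin q → List (Fin q)
    differences x = concatMap (λ y → if ⌊ x ≟ y ⌋ then [] else [ x - y ]) xs

    length+δ≡1 : ∀ x y → length (if ⌊ x ≟ y ⌋ then [] else [ x - y ]) + δ x y ≡ 1
    length+δ≡1 x y with x ≟ y
    ... | yes _ = refl
    ... | no _  = refl

    length-differences+1 : ∀ {x} → x ∈ xs → length (differences x) + 1 ≡ length xs
    length-differences+1 {x} x∈ = begin
      length (differences x) + 1
        ≡⟨ cong₂ _+_ (length-concatMap _ xs) (sym (∑δ-∈ x xs xs-u x∈)) ⟩
      ∑ (λ y → length (if ⌊ x ≟ y ⌋ then [] else [ x - y ])) xs + ∑ (δ x) xs
        ≡⟨ ∑-+ _ (δ x) xs ⟨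
      ∑ (λ y → length (if ⌊ x ≟ y ⌋ then [] else [ x - y ]) + δ x y) xs
        ≡⟨ ∑-cong xs (length+δ≡1 x) ⟩
      ∑ (λ _ → 1) xs
        ≡⟨ length≡∑1 xs ⟨
      length xs ∎

    length-differences : ∀ {x} → x ∈ xs → length (differences x) ≡ length xs ∸ 1
    length-differences {x} x∈ = trans (sym (m+n∸n≡m _ 1)) (cong (_∸ 1) (length-differences+1 x∈))

  target-∈ : ∀ {S} l μ {z} → z ∈ S → target S l μ z ≡ l
  target-∈ {S} l μ {z} z∈ with z ∈? S | z ≟ 0#
  ... | yes _ | yes _ = +-identityʳ l
  ... | yes _ | no _  = +-identityʳ l
  ... | no z∉ | _     = contradiction z∈ z∉

  target-0-≤ : ∀ S μ z → target S 0 μ z ≤ μ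
  target-0-≤ S μ z with z ∈? S | z ≟ 0#
  ... | yes _ | yes _ = z≤n
  ... | yes _ | no _  = z≤n
  ... | no _  | yes _ = z≤n
  ... | no _  | no _  = ≤-refl

  target-∉ : ∀ {S} l μ {z} → z ∉ S → z ≢ 0# → target S l μ z ≡ μ
  target-∉ {S} l μ {z} z∉ z≢0 with z ∈? S | z ≟ 0#
  ... | yes z∈ | _      = contradiction z∈ z∉
  ... | no _   | yes z≡0 = contradiction z≡0 z≢0
  ... | no _   | no _   = refl

  target-∸ : ∀ S l c μ z → target S l μ z ∸ target S c 0 z ≡ target S (l ∸ c) μ z
  target-∸ S l c μ z with z ∈? S | z ≟ 0#
  ... | yes _ | yes _ = trans (cong₂ _∸_ (+-identityʳ l) (+-identityʳ c)) (sym (+-identityʳ (l ∸ c)))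
  ... | yes _ | no _  = trans (cong₂ _∸_ (+-identityʳ l) (+-identityʳ c)) (sym (+-identityʳ (l ∸ c)))
  ... | no _  | yes _ = refl
  ... | no _  | no _  = refl

  target-resp-∈ : ∀ {S T} → (∀ x → x ∈ S ⇔ x ∈ T) → ∀ l μ z → target S l μ z ≡ target T l μ z
  target-resp-∈ {S} {T} S≈T l μ z with z ∈? S | z ∈? T
  ... | yes _  | yes _  = refl
  ... | no _   | no _   = refl
  ... | yes z∈ | no z∉  = contradiction (Equivalence.to (S≈T z) z∈) z∉
  ... | no z∉  | yes z∈ = contradiction (Equivalence.from (S≈T z) z∈) z∉

  -- μ (|S| + 1) is moved to the left to avoid the truncated subtraction μ (q - 1 - |S|).
  ∑-target : ∀ {S} → Unique S → All (_≢ 0#) S → ∀ l μ →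
             ∑ (target S l μ) (allFin q) + μ * (length S + 1) ≡ l * length S + μ * q
  ∑-target {S} S-u S-nonzero l μ = begin
    ∑ (target S l μ) (allFin q) + μ * (length S + 1)
      ≡⟨ cong (λ t → ∑ (target S l μ) (allFin q) + μ * t)
              (cong₂ _+_ (∑-multiplicities≡length S)
                         (trans (∑-cong (allFin q) (λ z → δ-sym z 0#)) (∑δ-allFin 0#))) ⟨
    ∑ (target S l μ) (allFin q) + μ * (∑ ι (allFin q) + ∑ (λ z → δ z 0#) (allFin q))
      ≡⟨ cong (λ t → ∑ (target S l μ) (allFin q) + μ * t) (∑-+ ι (λ z → δ z 0#) (allFin q)) ⟨
    ∑ (target S l μ) (allFin q) + μ * ∑ (λ z → ι z + δ z 0#) (allFin q)
      ≡⟨ cong (∑ (target S l μ) (allFin q) +_) (∑-*ˡ μ _ (allFin q)) ⟨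
    ∑ (target S l μ) (allFin q) + ∑ (λ z → μ * (ι z + δ z 0#)) (allFin q)
      ≡⟨ ∑-+ _ _ (allFin q) ⟨
    ∑ (λ z → target S l μ z + μ * (ι z + δ z 0#)) (allFin q)
      ≡⟨ ∑-cong (allFin q) pointwise ⟩
    ∑ (λ z → l * ι z + μ) (allFin q)
      ≡⟨ ∑-+ _ _ (allFin q) ⟩
    ∑ (λ z → l * ι z) (allFin q) + ∑ (λ _ → μ) (allFin q)
      ≡⟨ cong₂ _+_ (trans (∑-*ˡ l ι (allFin q)) (cong (l *_) (∑-multiplicities≡length S)))
                   (trans (∑-const μ (allFin q)) (trans (cong (_* μ) (length-tabulate {n = q} id)) (*-comm q μ))) ⟩
    l * length S + μ * q ∎
    where
    open ≡-Reasoning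
    ι : Fin q → ℕ
    ι z = ∑ (δ z) S

    in-S : l + 0 + μ * (1 + 0) ≡ l * 1 + μ
    in-S = solve (l ∷ μ ∷ [])
    at-0 : 0 + 0 + μ * (0 + 1) ≡ l * 0 + μ
    at-0 = solve (l ∷ μ ∷ [])
    elsewhere : 0 + μ + μ * (0 + 0) ≡ l * 0 + μ
    elsewhere = solve (l ∷ μ ∷ [])

    pointwise : ∀ z → target S l μ z + μ * (ι z + δ z 0#) ≡ l * ι z + μ
    pointwise z rewrite ∑δ-unique z S S-u with z ∈? S | z ≟ 0#
    ... | yes z∈ | yes z≡0 = contradiction z≡0 (All.lookup S-nonzero z∈)
    ... | yes _  | no _    = in-S
    ... | no _   | yes _   = at-0
    ... | no _   | no _    = elsewhere

  module Family {m : ℕ} (D : Fin m → List (Fin q)) where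

    internal : List (Fin q)
    internal = concatMap (λ i → Δ (D i)) (allFin m)

    external : List (Fin q)
    external = concatMap (λ i → concatMap (λ j →
                 if ⌊ i ≟ j ⌋ then [] else Δ₂ (D i) (D j)) (allFin m)) (allFin m)

    cross-count : Fin q → Fin m → Fin m → ℕ
    cross-count z i j = ∑ (λ x → ∑ (diff-count z x) (D j)) (D i)

    cross-count-neg : ∀ z i j → cross-count z i j ≡ cross-count (- z) j i
    cross-count-neg z i j = trans (∑-comm (diff-count z) (D i) (D j))
      (∑-cong (D j) (λ y → ∑-cong (D i) (λ x → diff-count-neg z x y)))

    count-internal : ∀ z → count z internal ≡ ∑ (λ i → cross-count z i i) (allFin m)
    count-internal z = trans (count≡∑δ z internal) (trans (∑-concatMap (δ z) _ (allFin m))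
      (∑-cong (allFin m) (λ i → trans (sym (count≡∑δ z (Δ (D i)))) (count-Δ z (D i)))))

    count-internal-neg : ∀ z → count z internal ≡ count (- z) internal
    count-internal-neg z = begin
      count z internal                                  ≡⟨ count-internal z ⟩
      ∑ (λ i → cross-count z i i) (allFin m)            ≡⟨ ∑-cong (allFin m) (λ i → cross-count-neg z i i) ⟩
      ∑ (λ i → cross-count (- z) i i) (allFin m)        ≡⟨ count-internal (- z) ⟨
      count (- z) internal                              ∎
      where open ≡-Reasoning

    ∈-union⁺ : ∀ {x} i → x ∈ D i → x ∈ union D
    ∈-union⁺ i x∈ = ∈-concatMap⁺ D (lose (∈-allFin i) x∈)

    ∈-union⁻ : ∀ {x} → x ∈ union D → ∃ λ i → x ∈ D i
    ∈-union⁻ x∈ = satisfied (∈-concatMap⁻ D {xs = allFin m} x∈)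

    off-diagonal : Fin q → Fin m → Fin m → ℕ
    off-diagonal z i j = if ⌊ i ≟ j ⌋ then 0 else cross-count z i j

    row-split : ∀ z i → ∑ (cross-count z i) (allFin m) ≡ cross-count z i i + ∑ (off-diagonal z i) (allFin m)
    row-split z i = begin
      ∑ (cross-count z i) (allFin m)
        ≡⟨ ∑-cong (allFin m) diagonal+off ⟩
      ∑ (λ j → δ i j * cross-count z i j + off-diagonal z i j) (allFin m)
        ≡⟨ ∑-+ _ _ (allFin m) ⟩
      ∑ (λ j → δ i j * cross-count z i j) (allFin m) + ∑ (off-diagonal z i) (allFin m)
        ≡⟨ cong (_+ ∑ (off-diagonal z i) (allFin m))
                (trans (∑δ-* i (cross-count z i) (allFin m)) (cong (_* cross-count z i i) (∑δ-allFin i))) ⟩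
      1 * cross-count z i i + ∑ (off-diagonal z i) (allFin m)
        ≡⟨ cong (_+ ∑ (off-diagonal z i) (allFin m)) (*-identityˡ _) ⟩
      cross-count z i i + ∑ (off-diagonal z i) (allFin m) ∎
      where
      open ≡-Reasoning
      diagonal+off : ∀ j → cross-count z i j ≡ δ i j * cross-count z i j + off-diagonal z i j
      diagonal+off j with i ≟ j
      ... | yes _ = sym (trans (+-identityʳ _) (+-identityʳ _))
      ... | no _  = refl

    module _ {k : ℕ} (fam : IsFamily m D k) where

      private
        D-unique : ∀ i → Unique (D i)
        D-unique i = proj₁ (proj₁ (proj₁ fam i))

        length-D : ∀ i → length (D i) ≡ k
        length-D i = proj₂ (proj₁ (proj₁ fam i))

        disjoint : ∀ i j → i ≢ j → ∀ x → x ∈ D i → x ∉ D j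
        disjoint = proj₂ fam

      union-unique : Unique (union D)
      union-unique = concat⁺ (All.map⁺ (All.tabulate (λ {i} _ → D-unique i)))
        (AllPairs.map⁺ (AllPairs.map (λ {i} {j} i≢j {x} (x∈i , x∈j) → disjoint i j i≢j x x∈i x∈j) (allFin⁺ m)))

      union-nonzero : All (_≢ 0#) (union D)
      union-nonzero = All.tabulate λ x∈ → let (i , x∈Di) = ∈-union⁻ x∈ in All.lookup (proj₂ (proj₁ fam i)) x∈Di

      length-union : length (union D) ≡ m * k
      length-union = begin
        length (union D)                       ≡⟨ length-concatMap D (allFin m) ⟩
        ∑ (λ i → length (D i)) (allFin m)      ≡⟨ ∑-cong (allFin m) length-D ⟩
        ∑ (λ _ → k) (allFin m)                 ≡⟨ ∑-const k (allFin m) ⟩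
        length (allFin m) * k                  ≡⟨ cong (_* k) (length-tabulate {n = m} id) ⟩
        m * k                                  ∎
        where open ≡-Reasoning

      length-internal : length internal ≡ m * (k * (k ∸ 1))
      length-internal = begin
        length internal                                  ≡⟨ length-concatMap _ (allFin m) ⟩
        ∑ (λ i → length (Δ (D i))) (allFin m)            ≡⟨ ∑-cong (allFin m) (λ i → trans (length-Δ (D-unique i))
                                                              (cong (λ t → t * (t ∸ 1)) (length-D i))) ⟩
        ∑ (λ _ → k * (k ∸ 1)) (allFin m)                 ≡⟨ ∑-const _ (allFin m) ⟩
        length (allFin m) * (k * (k ∸ 1))                ≡⟨ cong (_* _) (length-tabulate {n = m} id) ⟩
        m * (k * (k ∸ 1))                                ∎
        where open ≡-Reasoning

      dpdf-counting : ∀ {l μ} → (∀ z → count z internal ≡ target (union D) l μ z) →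
                      m * (k * (k ∸ 1)) + μ * (m * k + 1) ≡ l * (m * k) + μ * q
      dpdf-counting {l} {μ} counts = begin
        m * (k * (k ∸ 1)) + μ * (m * k + 1)
          ≡⟨ cong₂ (λ a b → a + μ * (b + 1)) length-internal length-union ⟨
        length internal + μ * (length (union D) + 1)
          ≡⟨ cong (_+ μ * (length (union D) + 1)) (∑-multiplicities≡length internal) ⟨
        ∑ (λ z → ∑ (δ z) internal) (allFin q) + μ * (length (union D) + 1)
          ≡⟨ cong (_+ μ * (length (union D) + 1))
                  (∑-cong (allFin q) (λ z → trans (sym (count≡∑δ z internal)) (counts z))) ⟩
        ∑ (target (union D) l μ) (allFin q) + μ * (length (union D) + 1)
          ≡⟨ ∑-target union-unique union-nonzero l μ ⟩
        l * length (union D) + μ * q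
          ≡⟨ cong (λ t → l * t + μ * q) length-union ⟩
        l * (m * k) + μ * q ∎
        where open ≡-Reasoning

      count-external : ∀ z → count z external ≡ ∑ (λ i → ∑ (off-diagonal z i) (allFin m)) (allFin m)
      count-external z = trans (count≡∑δ z external) (trans (∑-concatMap (δ z) _ (allFin m))
        (∑-cong (allFin m) (λ i → trans (∑-concatMap (δ z) _ (allFin m)) (∑-cong (allFin m) (pair-count i)))))
        where
        pair-count : ∀ i j → ∑ (δ z) (if ⌊ i ≟ j ⌋ then [] else Δ₂ (D i) (D j)) ≡ off-diagonal z i j
        pair-count i j with i ≟ j
        ... | yes _  = refl
        ... | no i≢j = trans (∑-concatMap (δ z) _ (D i)) (∑-cong-∈ (D i) λ x∈ →
            trans (∑-map (δ z) _ (D j)) (∑-cong-∈ (D j) λ y∈ →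
              sym (diff-count-≢ z (λ { refl → disjoint i j i≢j _ x∈ y∈ }))))

      count-Δ-union : ∀ z → count z (Δ (union D)) ≡ count z internal + count z external
      count-Δ-union z = begin
        count z (Δ (union D))
          ≡⟨ count-Δ z (union D) ⟩
        ∑ (λ x → ∑ (diff-count z x) (union D)) (union D)
          ≡⟨ ∑-concatMap _ D (allFin m) ⟩
        ∑ (λ i → ∑ (λ x → ∑ (diff-count z x) (union D)) (D i)) (allFin m)
          ≡⟨ ∑-cong (allFin m) (λ i → ∑-cong (D i) (λ x → ∑-concatMap (diff-count z x) D (allFin m))) ⟩
        ∑ (λ i → ∑ (λ x → ∑ (λ j → ∑ (diff-count z x) (D j)) (allFin m)) (D i)) (allFin m)
          ≡⟨ ∑-cong (allFin m) (λ i → ∑-comm _ (D i) (allFin m)) ⟩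
        ∑ (λ i → ∑ (cross-count z i) (allFin m)) (allFin m)
          ≡⟨ ∑-cong (allFin m) (row-split z) ⟩
        ∑ (λ i → cross-count z i i + ∑ (off-diagonal z i) (allFin m)) (allFin m)
          ≡⟨ ∑-+ _ _ (allFin m) ⟩
        ∑ (λ i → cross-count z i i) (allFin m) + ∑ (λ i → ∑ (off-diagonal z i) (allFin m)) (allFin m)
          ≡⟨ cong₂ _+_ (count-internal z) (count-external z) ⟨
        count z internal + count z external ∎
        where open ≡-Reasoning

      module _ {S : List (Fin q)} {ρ l μ : ℕ} (pds : IsPDS S ρ l μ) (S≈union : ∀ x → x ∈ S ⇔ x ∈ union D)
               (internal-counts : ∀ z → count z internal ≡ target (union D) (k ∸ 1) 0 z) where

        count-Δ-S : ∀ z → count z (Δ S) ≡ count z internal + count z external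
        count-Δ-S z = trans (count-Δ-resp {S} {union D} (same-multiplicities (proj₁ (proj₁ pds)) union-unique S≈union) z)
                            (count-Δ-union z)

        pds⇒external-counts : ∀ z → count z external ≡ target (union D) (l ∸ (k ∸ 1)) μ z
        pds⇒external-counts z = begin
          count z external
            ≡⟨ m+n∸m≡n (count z internal) (count z external) ⟨
          count z internal + count z external ∸ count z internal
            ≡⟨ cong₂ _∸_ (sym (count-Δ-S z)) (internal-counts z) ⟩
          count z (Δ S) ∸ target (union D) (k ∸ 1) 0 z
            ≡⟨ cong (_∸ target (union D) (k ∸ 1) 0 z) (trans (proj₂ pds z) (target-resp-∈ S≈union l μ z)) ⟩
          target (union D) l μ z ∸ target (union D) (k ∸ 1) 0 z
            ≡⟨ target-∸ (union D) l (k ∸ 1) μ z ⟩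
          target (union D) (l ∸ (k ∸ 1)) μ z ∎
          where open ≡-Reasoning

        pds⇒k∸1≤λ : ∀ {x} → x ∈ union D → k ∸ 1 ≤ l
        pds⇒k∸1≤λ {x} x∈ = subst₂ _≤_ (trans (internal-counts x) (target-∈ (k ∸ 1) 0 x∈))
          (trans (sym (count-Δ-S x)) (trans (proj₂ pds x) (target-∈ l μ (Equivalence.from (S≈union x) x∈))))
          (m≤m+n _ _)

module Arithmetic where
  open import Data.Nat using (zero; suc; _+_; _*_; _∸_; _≤_; _<_; z≤n; s≤s; NonZero)
  open import Data.Nat.Properties
  open import Data.Nat.Tactic.RingSolver using (solve-∀)
  open import Data.Product using (_×_; _,_)
  open import Data.Sum using (_⊎_; inj₁; inj₂)
  open import Function using (_⇔_; mk⇔)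
  open import Relation.Nullary using (contradiction)
  open import Relation.Binary.PropositionalEquality

  counting-identity⇒ : ∀ {m k ε l μ} → 0 < m → 0 < k → 0 < ε →
    m * (k * (k ∸ 1)) + μ * (m * k + 1) ≡ l * (m * k) + μ * (m * ε * k + 1) →
    k ∸ 1 ≡ l + μ * (ε ∸ 1)
  counting-identity⇒ {suc m′} {suc k′} {suc ε′} {l} {μ} _ _ _ eq =
    *-cancelˡ-≡ k′ (l + μ * ε′) (suc m′ * suc k′)
      (+-cancelʳ-≡ (μ * (suc m′ * suc k′ + 1)) _ _
        (trans (sym (left m′ k′ μ)) (trans eq (right m′ k′ ε′ l μ))))
    where
    left : ∀ m′ k′ μ → (1 + m′) * ((1 + k′) * k′) + μ * ((1 + m′) * (1 + k′) + 1)
                     ≡ (1 + m′) * (1 + k′) * k′ + μ * ((1 + m′) * (1 + k′) + 1)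
    left = solve-∀
    right : ∀ m′ k′ ε′ l μ → l * ((1 + m′) * (1 + k′)) + μ * ((1 + m′) * (1 + ε′) * (1 + k′) + 1)
                           ≡ (1 + m′) * (1 + k′) * (l + μ * ε′) + μ * ((1 + m′) * (1 + k′) + 1)
    right = solve-∀

  parameters-of-f<ε : ∀ {f ε φ₀ φ₁} → 0 < f → f < ε → f ∸ 1 ≡ φ₀ + φ₁ * (ε ∸ 1) →
                      φ₀ ≡ f ∸ 1 × φ₁ ≡ 0
  parameters-of-f<ε {φ₀ = φ₀} {zero}  _   _   eq = trans (sym (+-identityʳ φ₀)) (sym eq) , refl
  parameters-of-f<ε {f} {ε} {φ₀} {suc b} 0<f f<ε eq =
    contradiction (subst (ε ∸ 1 ≤_) (sym eq) (≤-trans (m≤m+n (ε ∸ 1) (b * (ε ∸ 1))) (m≤n+m _ φ₀)))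
                  (<⇒≱ (∸-monoˡ-< f<ε 0<f))

  parameters-of-ε≡f : ∀ {n φ₀ φ₁} → 0 < n → n ≡ φ₀ + φ₁ * n →
                      (φ₀ ≡ n × φ₁ ≡ 0) ⊎ (φ₀ ≡ 0 × φ₁ ≡ 1)
  parameters-of-ε≡f {n} {φ₀} {zero}          _   eq = inj₁ (sym (trans eq (+-identityʳ φ₀)) , refl)
  parameters-of-ε≡f {n} {φ₀} {suc zero}      _   eq =
    inj₂ (+-cancelʳ-≡ n φ₀ 0 (trans (cong (φ₀ +_) (sym (+-identityʳ n))) (sym eq)) , refl)
  parameters-of-ε≡f {n} {φ₀} {suc (suc b)} 0<n eq =
    contradiction (subst (n <_) (sym eq) (<-≤-trans (m<m+n n 0<n)
                    (≤-trans (+-monoʳ-≤ n (m≤m+n n (b * n))) (m≤n+m _ φ₀))))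
                  (<-irrefl refl)

  n<m*n⇒0<m : ∀ {m n} → n < m * n → 0 < m
  n<m*n⇒0<m {suc _} _ = s≤s z≤n

  ε*n≡m*ε*f⇒n≡m*f : ∀ {ε n m f} .{{_ : NonZero ε}} → ε * n ≡ m * ε * f → n ≡ m * f
  ε*n≡m*ε*f⇒n≡m*f {ε} {n} {m} {f} eq =
    *-cancelˡ-≡ n (m * f) ε (trans eq (trans (cong (_* f) (*-comm m ε)) (*-assoc ε m f)))

  ∸-≢⇔≢-+ : ∀ {m n o} → n ≤ m → (m ∸ n ≢ o) ⇔ (m ≢ o + n)
  ∸-≢⇔≢-+ {m} {n} {o} n≤m = mk⇔
    (λ m∸n≢o m≡o+n → m∸n≢o (trans (cong (_∸ n) m≡o+n) (m+n∸n≡m o n)))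
    (λ m≢o+n m∸n≡o → m≢o+n (trans (sym (m∸n+n≡m n≤m)) (cong (_+ n) m∸n≡o)))

module CyclotomicFamily {q : ℕ} (F : FiniteField q) {α : Fin q} (prim : FF.Primitive F α)
                        (e f ε m : ℕ) (q≡ef+1 : q ≡ e ℕ.* f ℕ.+ 1) where
  open import Data.Nat as ℕ using (suc; _+_; _*_; _∸_; _≤_; _<_; _>_; z≤n; s≤s; NonZero; >-nonZero)
  open import Data.Nat.Properties hiding (_≟_)
  open import Data.Nat.DivMod using (_%_; _/_; m%n<n; m≡m%n+[m/n]*n; m<n⇒m%n≡m; m<n*o⇒m/o<n)
  open import Data.Nat.Tactic.RingSolver using (solve-∀)
  open import Data.Fin using (Fin; toℕ; fromℕ<)
  open import Data.Fin.Properties using (_≟_; toℕ<n; toℕ-fromℕ<)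
  open import Data.List using (List; upTo; allFin)
  open import Data.List.Membership.Propositional using (_∈_)
  open import Data.List.Membership.Propositional.Properties using (∈-map⁺; ∈-map⁻; ∈-upTo⁺; ∈-upTo⁻; ∈-allFin)
  open import Data.List.Membership.DecPropositional (_≟_ {q}) using (_∈?_)
  open import Data.Product using (∃; _×_; _,_; proj₁; proj₂)
  open import Data.Sum using (_⊎_; inj₁; inj₂)
  open import Function using (_∘_; _⇔_; mk⇔)
  open import Relation.Nullary using (¬_; yes; no; contradiction)
  open import Relation.Binary.PropositionalEquality
  open FF F hiding (_+_; _*_)
  open FieldLemmas F
  open Sums
  open Multiplicity
  open DifferenceFamily F
  open Arithmetic

  private
    q∸1≡ef : q ∸ 1 ≡ e * f
    q∸1≡ef = trans (cong (_∸ 1) q≡ef+1) (m+n∸n≡m (e * f) 1)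

  η : Fin m → ℕ → Fin q
  η i j = α ^ (ε * toℕ i + e * j)

  D : Fin m → List (Fin q)
  D i = Cyc α (ε * toℕ i) e f

  open Family D

  η-∈ : ∀ i {j} → j < f → η i j ∈ D i
  η-∈ i j<f = ∈-map⁺ (η i) (∈-upTo⁺ j<f)

  ∈-D⇒η : ∀ {i x} → x ∈ D i → ∃ λ j → j < f × x ≡ η i j
  ∈-D⇒η {i} x∈ with ∈-map⁻ (η i) x∈
  ... | j , j∈ , x≡ = j , ∈-upTo⁻ j∈ , x≡

  ∈-C₀⇔∈-union : .{{_ : NonZero m}} → e ≡ m * ε → ∀ {ρ} → ρ ≡ m * f →
                 ∀ x → x ∈ Cyc α 0 ε ρ ⇔ x ∈ union D
  ∈-C₀⇔∈-union e≡mε {ρ} ρ≡mf x = mk⇔ to from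
    where
    εk≡ : ∀ k → ε * k ≡ ε * (k % m) + e * (k / m)
    εk≡ k = begin
      ε * k                               ≡⟨ cong (ε *_) (m≡m%n+[m/n]*n k m) ⟩
      ε * (k % m + k / m * m)             ≡⟨ distribute ε m (k % m) (k / m) ⟩
      ε * (k % m) + m * ε * (k / m)       ≡⟨ cong (λ t → ε * (k % m) + t * (k / m)) e≡mε ⟨
      ε * (k % m) + e * (k / m)           ∎
      where
      open ≡-Reasoning
      distribute : ∀ ε m r d → ε * (r + d * m) ≡ ε * r + m * ε * d
      distribute = solve-∀

    to : x ∈ Cyc α 0 ε ρ → x ∈ union D
    to x∈ with ∈-map⁻ _ x∈
    ... | k , k∈ , refl = subst (_∈ union D) (cong (α ^_) (trans ε[i]+ej≡ (sym (εk≡ k))))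
                            (∈-union⁺ i (η-∈ i (m<n*o⇒m/o<n (subst (k <_) (trans ρ≡mf (*-comm m f)) (∈-upTo⁻ k∈)))))
      where
      i : Fin m
      i = fromℕ< (m%n<n k m)
      ε[i]+ej≡ : ε * toℕ i + e * (k / m) ≡ ε * (k % m) + e * (k / m)
      ε[i]+ej≡ = cong (λ t → ε * t + e * (k / m)) (toℕ-fromℕ< (m%n<n k m))

    from : x ∈ union D → x ∈ Cyc α 0 ε ρ
    from x∈ with ∈-union⁻ x∈
    ... | i , x∈Di with ∈-D⇒η x∈Di
    ...   | j , j<f , refl = subst (_∈ Cyc α 0 ε ρ) (cong (α ^_) (exponent≡ (toℕ i) j))
                               (∈-map⁺ _ (∈-upTo⁺ k<ρ))
      where
      k<ρ : toℕ i + m * j < ρ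
      k<ρ = subst (toℕ i + m * j <_) (sym ρ≡mf)
              (≤-trans (+-monoˡ-< (m * j) (toℕ<n i)) (subst (_≤ m * f) (*-suc m j) (*-monoʳ-≤ m j<f)))
      exponent≡ : ∀ r j → 0 + ε * (r + m * j) ≡ ε * r + e * j
      exponent≡ r j = trans (distribute ε m r j) (cong (λ t → ε * r + t * j) (sym e≡mε))
        where
        distribute : ∀ ε m r j → 0 + ε * (r + m * j) ≡ ε * r + m * ε * j
        distribute = solve-∀

  count-internal-η : ∀ z → count z internal ≡
    ∑ (λ i → ∑ (λ a → ∑ (λ b → diff-count z (η i a) (η i b)) (upTo f)) (upTo f)) (allFin m)
  count-internal-η z = trans (count-internal z) (∑-cong (allFin m) λ i →
    trans (∑-map _ (η i) (upTo f)) (∑-cong (upTo f) λ a → ∑-map _ (η i) (upTo f)))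

  η-mod : .{{_ : NonZero f}} → ∀ i j → η i (j % f) ≡ η i j
  η-mod i j = begin
    α ^ (a + e * (j % f))                       ≡⟨ ^-+-period prim (a + e * (j % f)) (j / f) ⟨
    α ^ (a + e * (j % f) + (q ∸ 1) * (j / f))   ≡⟨ cong (λ t → α ^ (a + e * (j % f) + t * (j / f))) q∸1≡ef ⟩
    α ^ (a + e * (j % f) + e * f * (j / f))     ≡⟨ cong (α ^_) (regroup a e f (j % f) (j / f)) ⟩
    α ^ (a + e * (j % f + j / f * f))           ≡⟨ cong (λ t → α ^ (a + e * t)) (m≡m%n+[m/n]*n j f) ⟨
    α ^ (a + e * j)                             ∎
    where
    open ≡-Reasoning
    a : ℕ
    a = ε * toℕ i
    regroup : ∀ a e f r d → a + e * r + e * f * d ≡ a + e * (r + d * f)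
    regroup = solve-∀

  η-suc : ∀ i j → η i j ≡ - 1# → η i (suc j) ≡ - (α ^ e)
  η-suc i j ηij≡-1 = trans (cong (α ^_) (shift (ε * toℕ i) e j)) (^-+-of-≡-1 α (ε * toℕ i + e * j) e ηij≡-1)
    where
    shift : ∀ a e j → a + e * suc j ≡ a + e * j + e
    shift = solve-∀

  module _ (0<m : 0 < m) where

    i₀ : Fin m
    i₀ = fromℕ< 0<m

    private
      η-i₀ : ∀ j → η i₀ j ≡ α ^ (e * j)
      η-i₀ j = trans (cong (λ t → α ^ (ε * t + e * j)) (toℕ-fromℕ< 0<m)) (cong (λ t → α ^ (t + e * j)) (*-zeroʳ ε))

    η-i₀-0 : η i₀ 0 ≡ 1#
    η-i₀-0 = trans (η-i₀ 0) (cong (α ^_) (*-zeroʳ e))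

    η-i₀-1 : η i₀ 1 ≡ α ^ e
    η-i₀-1 = trans (η-i₀ 1) (cong (α ^_) (*-identityʳ e))

    1∈union : 0 < f → 1# ∈ union D
    1∈union 0<f = subst (_∈ union D) η-i₀-0 (∈-union⁺ i₀ (η-∈ i₀ 0<f))

    module _ (2<f : 2 < f) (0<e : 0 < e) where

      private
        instance
          f≢0 : NonZero f
          f≢0 = >-nonZero (<-trans (s≤s z≤n) 2<f)

        0<f : 0 < f
        0<f = <-trans (s≤s z≤n) 2<f

        1<f : 1 < f
        1<f = <-trans (s≤s (s≤s z≤n)) 2<f

        αᵉ≢1 : α ^ e ≢ 1#
        αᵉ≢1 = proj₂ prim e 0<e (subst (e <_) (sym q∸1≡ef) (m<m*n e f {{>-nonZero 0<e}} 1<f))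

        z : Fin q
        z = 1# - (α ^ e)

        z-from-i₀ : diff-count z (η i₀ 0) (η i₀ 1) ≡ 1
        z-from-i₀ = subst (λ w → diff-count w (η i₀ 0) (η i₀ 1) ≡ 1) (cong₂ _-_ η-i₀-0 η-i₀-1)
          (diff-count-self λ η₀₀≡η₀₁ → αᵉ≢1 (trans (sym η-i₀-1) (trans (sym η₀₀≡η₀₁) η-i₀-0)))

        z-from-ηsj≡-1 : ∀ {s j} → η s j ≡ - 1# → diff-count z (η s (suc j % f)) (η s j) ≡ 1
        z-from-ηsj≡-1 {s} {j} ηsj≡-1 = subst (λ w → diff-count w (η s (suc j % f)) (η s j) ≡ 1)
          (trans (cong₂ _-_ ηs[j+1]≡-αᵉ ηsj≡-1) (sym (1-x≡-x-[-1] (α ^ e))))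
          (diff-count-self λ ηs[j+1]≡ηsj →
            αᵉ≢1 (-‿injective (trans (sym ηs[j+1]≡-αᵉ) (trans ηs[j+1]≡ηsj ηsj≡-1))))
          where
          ηs[j+1]≡-αᵉ : η s (suc j % f) ≡ - (α ^ e)
          ηs[j+1]≡-αᵉ = trans (η-mod s (suc j)) (η-suc s j ηsj≡-1)

        -- The only place where f > 2 is needed: 2 mod f ≠ 0.
        positions-distinct : ∀ {s j} → (i₀ , 0 , 1) ≢ (s , suc j % f , j)
        positions-distinct {s} {j} eq = contradiction (begin
          2               ≡⟨ m<n⇒m%n≡m 2<f ⟨
          2 % f           ≡⟨ cong (λ j → suc j % f) (cong (proj₂ ∘ proj₂) eq) ⟩
          suc j % f       ≡⟨ cong (proj₁ ∘ proj₂) eq ⟨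
          0               ∎) λ ()
          where open ≡-Reasoning

        module _ (dpdf : IsDPDF m D f 0 1) where

          -1∈union : - 1# ∈ union D
          -1∈union with - 1# ∈? union D
          ... | yes -1∈ = -1∈
          ... | no -1∉  = contradiction 1≡0 λ ()
            where
            open ≡-Reasoning
            1≡0 : 1 ≡ 0
            1≡0 = begin
              1                                 ≡⟨ target-∉ 0 1 -1∉ -1≢0 ⟨
              target (union D) 0 1 (- 1#)       ≡⟨ proj₂ dpdf (- 1#) ⟨
              count (- 1#) internal             ≡⟨ count-internal-neg (- 1#) ⟩
              count (- (- 1#)) internal         ≡⟨ cong (λ w → count w internal) (-‿involutive 1#) ⟩
              count 1# internal                 ≡⟨ proj₂ dpdf 1# ⟩
              target (union D) 0 1 1#           ≡⟨ target-∈ 0 1 (1∈union 0<f) ⟩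
              0                                 ∎

          two≤count : 2 ≤ count z internal
          two≤count with ∈-union⁻ -1∈union
          ... | s , -1∈Ds with ∈-D⇒η -1∈Ds
          ...   | j , j<f , -1≡ηsj = begin
            2                                                   ≡⟨ cong₂ _+_ z-from-i₀ (z-from-ηsj≡-1 (sym -1≡ηsj)) ⟨
            t i₀ 0 1 + t s (suc j % f) j                        ≤⟨ ∑∑∑-∈₂ _≟_ ℕ._≟_ t positions-distinct
                                                                     (∈-allFin i₀) (∈-allFin s)
                                                                     (∈-upTo⁺ 0<f) (∈-upTo⁺ (m%n<n (suc j) f))
                                                                     (∈-upTo⁺ 1<f) (∈-upTo⁺ j<f) ⟩
            ∑ (λ i → ∑ (λ a → ∑ (t i a) (upTo f)) (upTo f)) (allFin m)
                                                                ≡⟨ count-internal-η z ⟨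
            count z internal                                    ∎
            where
            open ≤-Reasoning
            t : Fin m → ℕ → ℕ → ℕ
            t i a b = diff-count z (η i a) (η i b)

      ¬IsDPDF-0-1 : ¬ IsDPDF m D f 0 1
      ¬IsDPDF-0-1 dpdf = <-irrefl refl (≤-trans (two≤count dpdf)
        (subst (_≤ 1) (sym (proj₂ dpdf z)) (target-0-≤ (union D) 1 z)))

    f∸1≡φ₀+φ₁[ε∸1] : ∀ {φ₀ φ₁} → 0 < f → 0 < ε → e ≡ m * ε → IsDPDF m D f φ₀ φ₁ →
                     f ∸ 1 ≡ φ₀ + φ₁ * (ε ∸ 1)
    f∸1≡φ₀+φ₁[ε∸1] {φ₀} {φ₁} 0<f 0<ε e≡mε (fam , counts) =
      counting-identity⇒ {l = φ₀} {φ₁} 0<m 0<f 0<ε (trans (dpdf-counting fam counts)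
        (cong (λ t → φ₀ * (m * f) + φ₁ * t) (trans q≡ef+1 (cong (λ t → t * f + 1) e≡mε))))

    dpdf-parameters : ∀ {φ₀ φ₁} → 1 < f → 0 < ε → 0 < e → e ≡ m * ε → IsDPDF m D f φ₀ φ₁ →
                      ε > f ⊎ (ε > 2 × ε ≡ f) → φ₀ ≡ f ∸ 1 × φ₁ ≡ 0
    dpdf-parameters 1<f 0<ε _ e≡mε dpdf (inj₁ f<ε) =
      parameters-of-f<ε (<-trans (s≤s z≤n) 1<f) f<ε (f∸1≡φ₀+φ₁[ε∸1] (<-trans (s≤s z≤n) 1<f) 0<ε e≡mε dpdf)
    dpdf-parameters {φ₀} {φ₁} 1<f 0<ε 0<e e≡mε dpdf (inj₂ (2<ε , ε≡f))
      with parameters-of-ε≡f (m<n⇒0<n∸m 1<f) (subst (λ t → f ∸ 1 ≡ φ₀ + φ₁ * (t ∸ 1)) ε≡f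
             (f∸1≡φ₀+φ₁[ε∸1] (<-trans (s≤s z≤n) 1<f) 0<ε e≡mε dpdf))
    ... | inj₁ φ≡             = φ≡
    ... | inj₂ (φ₀≡0 , φ₁≡1) = contradiction (subst₂ (IsDPDF m D f) φ₀≡0 φ₁≡1 dpdf)
                                             (¬IsDPDF-0-1 (subst (2 <_) ε≡f 2<ε) 0<e)

open import Data.Nat using (ℕ; _≤_; _*_; _+_; _∸_; _<_; _>_)
open import Data.Fin using (Fin; toℕ)
open import Data.Product using (_×_; Σ)
open import Data.Sum using (_⊎_)
open import Function.Bundles using (_⇔_)
open import Relation.Binary.PropositionalEquality using (_≡_; _≢_)

open import Data.Nat using (z≤n; s≤s; >-nonZero)
open import Data.Nat.Properties using (<-trans; +-cancelʳ-≡)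
open import Data.Product using (_,_; proj₁; proj₂)
open import Data.Sum using (inj₁; inj₂)
open import Data.List.Membership.Propositional using (_∈_)
open import Relation.Binary.PropositionalEquality using (sym; trans; cong; subst; subst₂)
open Arithmetic

theorem5p12 :
    (q : ℕ) → IsPrimePower q → (F : FiniteField q) →
    (α : Fin q) → FF.Primitive F α →
    (e f ε ρ m : ℕ) → q ≡ e * f + 1 → q ≡ ε * ρ + 1 →
    1 < e → 1 < f → 1 < ε → 1 < ρ →
    e ≡ m * ε → e > ε →
    (φ₀ φ₁ : ℕ) →
    FF.IsDPDF F m (λ i → FF.Cyc F α (ε * toℕ i) e f) f φ₀ φ₁ →
    (ε > f → φ₀ ≡ f ∸ 1 × φ₁ ≡ 0
               × FF.IsDPDF F m (λ i → FF.Cyc F α (ε * toℕ i) e f) f (f ∸ 1) 0)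
    × (ε > 2 → ε ≡ f → FF.IsDPDF F m (λ i → FF.Cyc F α (ε * toℕ i) e f) f (f ∸ 1) 0)
    × ((λ' μ : ℕ) → (ε > f ⊎ (ε > 2 × ε ≡ f)) →
         FF.IsPDS F (FF.Cyc F α 0 ε ρ) ρ λ' μ →
         (f ∸ 1 ≤ λ') ×
         FF.IsEPDF F m (λ i → FF.Cyc F α (ε * toℕ i) e f) f (λ' ∸ (f ∸ 1)) μ
         × ((λ' ∸ (f ∸ 1) ≢ μ) ⇔ (λ' ≢ μ + (f ∸ 1))))
theorem5p12 q _ F α prim e f ε ρ m q≡ef+1 q≡ερ+1 1<e 1<f 1<ε _ e≡mε ε<e φ₀ φ₁ dpdf =
    (λ f<ε → proj₁ (parameters (inj₁ f<ε)) , proj₂ (parameters (inj₁ f<ε)) , normalised (inj₁ f<ε))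
  , (λ 2<ε ε≡f → normalised (inj₂ (2<ε , ε≡f)))
  , λ λ′ μ cases pds →
      let internal-counts = proj₂ (normalised cases)
          f∸1≤λ = pds⇒k∸1≤λ fam pds C₀≈union internal-counts (1∈union 0<m (<-trans (s≤s z≤n) 1<f))
      in f∸1≤λ , (fam , pds⇒external-counts fam pds C₀≈union internal-counts) , ∸-≢⇔≢-+ f∸1≤λ
  where
  open CyclotomicFamily F prim e f ε m q≡ef+1
  open DifferenceFamily F
  open Family D

  fam : FF.IsFamily F m D f
  fam = proj₁ dpdf

  0<ε : 0 < ε
  0<ε = <-trans (s≤s z≤n) 1<ε

  0<m : 0 < m
  0<m = n<m*n⇒0<m (subst (ε <_) e≡mε ε<e)

  ρ≡mf : ρ ≡ m * f
  ρ≡mf = ε*n≡m*ε*f⇒n≡m*f {m = m} {f = f} {{>-nonZero 0<ε}}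
           (+-cancelʳ-≡ 1 _ _ (trans (sym q≡ερ+1) (trans q≡ef+1 (cong (λ t → t * f + 1) e≡mε))))

  C₀≈union : ∀ x → x ∈ FF.Cyc F α 0 ε ρ ⇔ x ∈ FF.union F D
  C₀≈union = ∈-C₀⇔∈-union {{>-nonZero 0<m}} e≡mε ρ≡mf

  parameters : ε > f ⊎ (ε > 2 × ε ≡ f) → φ₀ ≡ f ∸ 1 × φ₁ ≡ 0
  parameters = dpdf-parameters 0<m 1<f 0<ε (<-trans (s≤s z≤n) 1<e) e≡mε dpdf

  normalised : ε > f ⊎ (ε > 2 × ε ≡ f) → FF.IsDPDF F m D f (f ∸ 1) 0
  normalised c = subst₂ (FF.IsDPDF F m D f) (proj₁ (parameters c)) (proj₂ (parameters c)) dpdf
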